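{- Let $R=\mathbb{Z}[h_{r,s}: r\ge1,\ s\in\mathbb{Z}]$ and let the notation $\varphi$, $h_r$, $e_r$ be as in the context. Then the two $\mathbb{Z}\times\mathbb{Z}$-matrices \[\widetilde H=\left(\varphi^{1+i}h_{j-i}\right)_{i,j\in\mathbb{Z}}\quad\text{and}\quad \widetilde E=\left((-1)^{j-i}\varphi^{j}e_{j-i}\right)_{i,j\in\mathbb{Z}}\] are inverses of each other.
   Context: $R$ is the polynomial ring over $\mathbb{Z}$ in indeterminates $h_{r,s}$ ($r\ge1$, $s\in\mathbb{Z}$); set $h_{0,s}=1$ and $h_{r,s}=0$ for $r<0$. Let $\varphi$ be the ring automorphism of $R$ with $\varphi(h_{r,s})=h_{r,s+1}$, and $h_r:=h_{r,0}$, so $\varphi^s h_r=h_{r,s}$ for all $r,s\in\mathbb{Z}$. For partitions $\lambda,\mu$ and any $n$ with $\ell(\lambda),\ell(\mu)\le n$, set $s_{\lambda/\mu}=\det\left(\varphi^{\mu_j-j+1}h_{\lambda_i-\mu_j-i+j}\right)_{1\le i,j\le n}$ (independent of $n$), and $s_\lambda=s_{\lambda/\varnothing}$. Set $e_r=s_{(1^r)}$ for $r\ge0$ (where $(1^r)=(1,\ldots,1)$ with $r$ ones) and $e_r=0$ for $r<0$. -}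

module Defs where

open import Algebra.Bundles using (CommutativeRing)
open import Data.Nat as ℕ using (ℕ; zero; suc)
open import Data.Fin using (Fin; zero; suc; toℕ; punchIn)
open import Data.Integer as ℤ using (ℤ; +_; -[1+_])
open import Data.Bool using (if_then_else_)
open import Relation.Nullary.Decidable using (⌊_⌋)

-- Everything is parametrised by a commutative ring R and a family
-- x : ℕ → ℤ → R, where  x k s  plays the role of the indeterminate h_{k+1,s}.
-- Since ℤ[h_{r,s}] is the free commutative ring on these indeterminates, an
-- identity in it is the same as an identity valid for every such (R , x).
-- The automorphism φ^t (h_{r,s} ↦ h_{r,s+t}) is realised by substituting the
-- shifted family  shiftGen t x.

shiftGen : ∀ {a} {A : Set a} → ℤ → (ℕ → ℤ → A) → (ℕ → ℤ → A)
shiftGen t x k s = x k (s ℤ.+ t)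

module _ {c ℓ} (R : CommutativeRing c ℓ) where
  open CommutativeRing R using (_+_; _*_; -_; 0#; 1#) renaming (Carrier to A)

  sumFin : ∀ n → (Fin n → A) → A
  sumFin zero    f = 0#
  sumFin (suc n) f = f zero + sumFin n (λ j → f (suc j))

  sumN : ℕ → (ℕ → A) → A
  sumN zero    f = 0#
  sumN (suc n) f = f 0 + sumN n (λ t → f (suc t))

  signℕ : ℕ → A
  signℕ zero    = 1#
  signℕ (suc n) = - signℕ n

  signℤ : ℤ → A
  signℤ z = signℕ ℤ.∣ z ∣

  det : ∀ n → (Fin n → Fin n → A) → A
  det zero    M = 1#
  det (suc n) M =
    sumFin (suc n) (λ j → signℕ (toℕ j) * (M zero j * det n (λ a b → M (suc a) (punchIn j b))))

  hh : (ℕ → ℤ → A) → ℤ → ℤ → A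
  hh x (+ zero)    s = 1#
  hh x (+ (suc k)) s = x k s
  hh x -[1+ _ ]    s = 0#

  -- s_{λ/μ} = det( φ^{μ_j - j + 1} h_{λ_i - μ_j - i + j} )_{1≤i,j≤n}
  -- (rows/columns indexed by Fin n, the 1-based index being toℕ i + 1)
  skewSchur : (ℕ → ℤ → A) → (n : ℕ) → (Fin n → ℕ) → (Fin n → ℕ) → A
  skewSchur x n lam mu = det n (λ i j →
    let i' = + suc (toℕ i)
        j' = + suc (toℕ j)
    in hh x ((+ lam i) ℤ.- (+ mu j) ℤ.- i' ℤ.+ j') ((+ mu j) ℤ.- j' ℤ.+ ℤ.1ℤ))

  ee : (ℕ → ℤ → A) → ℤ → A
  ee x (+ r)     = skewSchur x r (λ _ → 1) (λ _ → 0)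
  ee x -[1+ _ ]  = 0#

  Htilde : (ℕ → ℤ → A) → ℤ → ℤ → A
  Htilde x i j = hh x (j ℤ.- i) (ℤ.1ℤ ℤ.+ i)

  Etilde : (ℕ → ℤ → A) → ℤ → ℤ → A
  Etilde x i j = signℤ (j ℤ.- i) * ee (shiftGen j x) (j ℤ.- i)

  δ : ℤ → ℤ → A
  δ i k = if ⌊ i ℤ.≟ k ⌋ then 1# else 0#

-- Expanding the determinant that defines φˢ e_{m+1} along its first row gives the recurrence
--   φˢ e_{m+1} = Σ_{j ≤ m} (-1)ʲ φ^{s-j} h_{j+1} · φ^{s-j-1} e_{m-j},
-- since deleting the first row and the column of index j (counting from 0) leaves a
-- block-triangular minor whose leading j × j block is unitriangular and whose trailing block is
-- the matrix of φ^{s-j-1} e_{m-j}.  Up to the sign (-1)^{m+1}, this recurrence says exactly that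
-- the band sums Σ_{i ≤ j ≤ k} Ẽ_{ij} H̃_{jk} vanish for i < k.  Both matrices are upper
-- triangular, so the window sums of the theorem reduce to these band sums, giving Ẽ H̃ = 1 on
-- every window.  On a window H̃ is a finite unitriangular matrix, so its left inverse Ẽ is also a
-- right inverse.
module Submission where

open import Defs
open import Algebra.Bundles using (CommutativeRing)
open import Data.Bool using (if_then_else_)
open import Data.Empty using (⊥-elim)
open import Data.Fin using (Fin; zero; suc; toℕ; punchIn)
open import Data.Integer as ℤ using (ℤ; +_; -[1+_]; _⊖_; 0ℤ; 1ℤ; -1ℤ)
import Data.Integer.Properties as ℤP
import Algebra.Properties.AbelianGroup ℤP.+-0-abelianGroup as ℤ+
open import Data.Integer.Tactic.RingSolver using (solve-∀)
open import Data.Maybe using (nothing)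
open import Data.Nat as ℕ using (ℕ; zero; suc; z≤n; s≤s; _∸_)
open import Data.Nat.Induction using (<-rec)
import Data.Nat.Properties as ℕP
open import Data.Product using (Σ; _×_; _,_)
open import Function using (_∘_)
open import Relation.Binary.PropositionalEquality using (_≡_; _≢_)
import Relation.Binary.PropositionalEquality as ≡
open import Relation.Nullary using (yes; no)
open import Relation.Nullary.Decidable using (⌊_⌋)
open import Tactic.RingSolver.Core.AlmostCommutativeRing using (fromCommutativeRing)

i+j-i≡j : ∀ i j → i ℤ.+ j ℤ.- i ≡ j
i+j-i≡j = solve-∀

-j+[i+[1+j]]≡1+i : ∀ i j → ℤ.- j ℤ.+ (i ℤ.+ (1ℤ ℤ.+ j)) ≡ 1ℤ ℤ.+ i
-j+[i+[1+j]]≡1+i = solve-∀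

i+[1+j]-[1+j]≡i : ∀ i j → i ℤ.+ (1ℤ ℤ.+ j) ℤ.- (1ℤ ℤ.+ j) ≡ i
i+[1+j]-[1+j]≡i = solve-∀

-[1+j]+i≡-j+[i-1] : ∀ i j → ℤ.- (1ℤ ℤ.+ j) ℤ.+ i ≡ ℤ.- j ℤ.+ (i ℤ.+ -1ℤ)
-[1+j]+i≡-j+[i-1] = solve-∀

i+[1+[j+k]]≡[i+k]+[1+j] : ∀ i j k → i ℤ.+ (1ℤ ℤ.+ (j ℤ.+ k)) ≡ (i ℤ.+ k) ℤ.+ (1ℤ ℤ.+ j)
i+[1+[j+k]]≡[i+k]+[1+j] = solve-∀

i<j⇒i-j<0 : ∀ {i j} → i ℤ.< j → i ℤ.- j ℤ.< 0ℤ
i<j⇒i-j<0 {i} {j} i<j = ≡.subst (i ℤ.- j ℤ.<_) (ℤP.+-inverseʳ j) (ℤP.+-monoˡ-< (ℤ.- j) i<j)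

window-index : ∀ {a i n} → a ℤ.≤ i → i ℤ.< a ℤ.+ + n → Σ ℕ λ p → p ℕ.< n × a ℤ.+ + p ≡ i
window-index {a} {i} {n} a≤i i<a+n =
  ℤ.∣ i ℤ.- a ∣ ,
  ℤP.drop‿+<+ (≡.subst₂ ℤ._<_ (≡.sym ∣i-a∣≡i-a) (i+j-i≡j a (+ n)) (ℤP.+-monoˡ-< (ℤ.- a) i<a+n)) ,
  ≡.trans (≡.cong (λ r → a ℤ.+ r) ∣i-a∣≡i-a) (i+[j-i]≡j a i)
  where
  ∣i-a∣≡i-a : + ℤ.∣ i ℤ.- a ∣ ≡ i ℤ.- a
  ∣i-a∣≡i-a = ℤP.0≤i⇒+∣i∣≡i (ℤP.i≤j⇒0≤j-i a≤i)
  i+[j-i]≡j : ∀ i j → i ℤ.+ (j ℤ.- i) ≡ j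
  i+[j-i]≡j = solve-∀

module _ {r ℓ} (R : CommutativeRing r ℓ) where
  open CommutativeRing R hiding (zero) renaming (Carrier to A)
  open import Tactic.RingSolver.NonReflective (fromCommutativeRing R (λ _ → nothing))
  open import Relation.Binary.Reasoning.Setoid setoid
  open import Algebra.Properties.Ring ring
    using ([y-z]x≈yx-zx; x∙y⁻¹≈ε⇒x≈y; x≈y⇒x∙y⁻¹≈ε; -‿distribˡ-*; -‿distribʳ-*; -‿involutive)

  sumN-cong : ∀ n {f g : ℕ → A} → (∀ {t} → t ℕ.< n → f t ≈ g t) → sumN R n f ≈ sumN R n g
  sumN-cong zero    f≈g = refl
  sumN-cong (suc n) f≈g = +-cong (f≈g (s≤s z≤n)) (sumN-cong n (λ t<n → f≈g (s≤s t<n)))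

  sumN-zero : ∀ n {f : ℕ → A} → (∀ {t} → t ℕ.< n → f t ≈ 0#) → sumN R n f ≈ 0#
  sumN-zero zero    f≈0 = refl
  sumN-zero (suc n) f≈0 =
    trans (+-cong (f≈0 (s≤s z≤n)) (sumN-zero n (λ t<n → f≈0 (s≤s t<n)))) (+-identityˡ 0#)

  sumN-distrib-+ : ∀ n (f g : ℕ → A) → sumN R n (λ t → f t + g t) ≈ sumN R n f + sumN R n g
  sumN-distrib-+ zero    f g = sym (+-identityˡ 0#)
  sumN-distrib-+ (suc n) f g =
    trans (+-congˡ (sumN-distrib-+ n (λ t → f (suc t)) (λ t → g (suc t)))) (interchange _ _ _ _)
    where
    interchange : ∀ a b c d → (a + b) + (c + d) ≈ (a + c) + (b + d)
    interchange = solve 4 (λ a b c d → ((a ⊕ b) ⊕ (c ⊕ d)) ⊜ ((a ⊕ c) ⊕ (b ⊕ d))) refl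

  sumN-distrib-− : ∀ n (f g : ℕ → A) → sumN R n (λ t → f t - g t) ≈ sumN R n f - sumN R n g
  sumN-distrib-− zero    f g = sym (-‿inverseʳ 0#)
  sumN-distrib-− (suc n) f g =
    trans (+-congˡ (sumN-distrib-− n (λ t → f (suc t)) (λ t → g (suc t)))) (interchange _ _ _ _)
    where
    interchange : ∀ a b c d → (a - b) + (c - d) ≈ (a + c) - (b + d)
    interchange = solve 4 (λ a b c d → ((a ⊕ (⊝ b)) ⊕ (c ⊕ (⊝ d))) ⊜ ((a ⊕ c) ⊕ (⊝ (b ⊕ d)))) refl

  *-distribˡ-sumN : ∀ n x (f : ℕ → A) → x * sumN R n f ≈ sumN R n (λ t → x * f t)
  *-distribˡ-sumN zero    x f = zeroʳ x
  *-distribˡ-sumN (suc n) x f = trans (distribˡ x _ _) (+-congˡ (*-distribˡ-sumN n x (λ t → f (suc t))))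

  *-distribʳ-sumN : ∀ n x (f : ℕ → A) → sumN R n f * x ≈ sumN R n (λ t → f t * x)
  *-distribʳ-sumN zero    x f = zeroˡ x
  *-distribʳ-sumN (suc n) x f = trans (distribʳ x _ _) (+-congˡ (*-distribʳ-sumN n x (λ t → f (suc t))))

  sumN-comm : ∀ n m (f : ℕ → ℕ → A) →
    sumN R n (λ t → sumN R m (f t)) ≈ sumN R m (λ u → sumN R n (λ t → f t u))
  sumN-comm zero    m f = sym (sumN-zero m (λ _ → refl))
  sumN-comm (suc n) m f =
    trans (+-congˡ (sumN-comm n m (λ t → f (suc t)))) (sym (sumN-distrib-+ m _ _))

  sumN-init-last : ∀ n (f : ℕ → A) → sumN R (suc n) f ≈ sumN R n f + f n
  sumN-init-last zero    f = trans (+-identityʳ _) (sym (+-identityˡ _))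
  sumN-init-last (suc n) f = trans (+-congˡ (sumN-init-last n (λ t → f (suc t)))) (sym (+-assoc _ _ _))

  sumN-reverse : ∀ n (f : ℕ → A) → sumN R (suc n) (λ t → f (n ∸ t)) ≈ sumN R (suc n) f
  sumN-reverse zero    f = refl
  sumN-reverse (suc n) f =
    trans (+-congˡ (sumN-reverse n f)) (trans (+-comm _ _) (sym (sumN-init-last (suc n) f)))

  sumN-single : ∀ n {q} (f : ℕ → A) → q ℕ.< n →
    (∀ {u} → u ℕ.< n → u ≢ q → f u ≈ 0#) → sumN R n f ≈ f q
  sumN-single (suc n) {zero}  f _         f≈0 =
    trans (+-congˡ (sumN-zero n (λ u<n → f≈0 (s≤s u<n) (λ ())))) (+-identityʳ _)
  sumN-single (suc n) {suc q} f (s≤s q<n) f≈0 =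
    trans (+-cong (f≈0 (s≤s z≤n) (λ ())) (sumN-single n (λ t → f (suc t)) q<n
            (λ u<n u≢q → f≈0 (s≤s u<n) (λ eq → u≢q (ℕP.suc-injective eq)))))
          (+-identityˡ _)

  sumN-truncate : ∀ n {L} (f : ℕ → A) → L ℕ.≤ n →
    (∀ {t} → L ℕ.≤ t → t ℕ.< n → f t ≈ 0#) → sumN R n f ≈ sumN R L f
  sumN-truncate n       {zero}  f _         f≈0 = sumN-zero n (f≈0 z≤n)
  sumN-truncate (suc n) {suc L} f (s≤s L≤n) f≈0 =
    +-congˡ (sumN-truncate n (λ t → f (suc t)) L≤n (λ L≤t t<n → f≈0 (s≤s L≤t) (s≤s t<n)))

  sumN-support : ∀ n p m (f : ℕ → A) → p ℕ.+ m ℕ.< n →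
    (∀ {t} → t ℕ.< p → f t ≈ 0#) → (∀ {t} → p ℕ.+ m ℕ.< t → t ℕ.< n → f t ≈ 0#) →
    sumN R n f ≈ sumN R (suc m) (λ d → f (p ℕ.+ d))
  sumN-support n       zero    m f m<n _ f>m≈0 = sumN-truncate n f m<n f>m≈0
  sumN-support (suc n) (suc p) m f (s≤s p+m<n) f<p≈0 f>p+m≈0 =
    trans (+-cong (f<p≈0 (s≤s z≤n)) (sumN-support n p m (λ t → f (suc t)) p+m<n
            (λ t<p → f<p≈0 (s≤s t<p)) (λ p+m<t t<n → f>p+m≈0 (s≤s p+m<t) (s≤s t<n))))
          (+-identityˡ _)

  sumFin-cong : ∀ n {f g : Fin n → A} → (∀ j → f j ≈ g j) → sumFin R n f ≈ sumFin R n g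
  sumFin-cong zero    f≈g = refl
  sumFin-cong (suc n) f≈g = +-cong (f≈g zero) (sumFin-cong n (λ j → f≈g (suc j)))

  sumFin-zero : ∀ n {f : Fin n → A} → (∀ j → f j ≈ 0#) → sumFin R n f ≈ 0#
  sumFin-zero zero    f≈0 = refl
  sumFin-zero (suc n) f≈0 = trans (+-cong (f≈0 zero) (sumFin-zero n (λ j → f≈0 (suc j)))) (+-identityˡ 0#)

  sumFin-toℕ : ∀ n (g : ℕ → A) → sumFin R n (λ j → g (toℕ j)) ≡ sumN R n g
  sumFin-toℕ zero    g = ≡.refl
  sumFin-toℕ (suc n) g = ≡.cong (λ r → g 0 + r) (sumFin-toℕ n (λ t → g (suc t)))

  det-cong : ∀ n {M N : Fin n → Fin n → A} → (∀ a b → M a b ≈ N a b) → det R n M ≈ det R n N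
  det-cong zero    M≈N = refl
  det-cong (suc n) M≈N = sumFin-cong (suc n) (λ j →
    *-congˡ {signℕ R (toℕ j)} (*-cong (M≈N zero j) (det-cong n (λ a b → M≈N (suc a) (punchIn j b)))))

  mutual
    det-firstColumn : ∀ n (M : Fin (suc n) → Fin (suc n) → A) → (∀ a → M (suc a) zero ≈ 0#) →
      det R (suc n) M ≈ M zero zero * det R n (λ a b → M (suc a) (suc b))
    det-firstColumn n M col≈0 =
      trans (+-cong (*-identityˡ _) (sumFin-zero n (λ j →
               trans (*-congˡ (*-congˡ (det-minor-zero n M j col≈0))) (trans (*-congˡ (zeroʳ _)) (zeroʳ _)))))
            (+-identityʳ _)

    det-zeroColumn : ∀ n (M : Fin (suc n) → Fin (suc n) → A) → (∀ a → M a zero ≈ 0#) → det R (suc n) M ≈ 0#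
    det-zeroColumn n M col≈0 =
      trans (det-firstColumn n M (λ a → col≈0 (suc a))) (trans (*-congʳ (col≈0 zero)) (zeroˡ _))

    det-minor-zero : ∀ n (M : Fin (suc n) → Fin (suc n) → A) (j : Fin n) → (∀ a → M (suc a) zero ≈ 0#) →
      det R n (λ a b → M (suc a) (punchIn (suc j) b)) ≈ 0#
    det-minor-zero (suc n) M j col≈0 = det-zeroColumn n (λ a b → M (suc a) (punchIn (suc j) b)) col≈0

  Matrix : Set r
  Matrix = ℕ → ℕ → A

  mul : ℕ → Matrix → Matrix → Matrix
  mul n M N p q = sumN R n (λ t → M p t * N t q)

  identity : Matrix
  identity p q = if ⌊ p ℕ.≟ q ⌋ then 1# else 0#

  identity-diag : ∀ p → identity p p ≈ 1#
  identity-diag p with p ℕ.≟ p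
  ... | yes _   = refl
  ... | no p≢p = ⊥-elim (p≢p ≡.refl)

  identity-offDiag : ∀ {p q} → p ≢ q → identity p q ≈ 0#
  identity-offDiag {p} {q} p≢q with p ℕ.≟ q
  ... | yes p≡q = ⊥-elim (p≢q p≡q)
  ... | no _    = refl

  UpperTriangular : Matrix → Set ℓ
  UpperTriangular M = ∀ {t u} → u ℕ.< t → M t u ≈ 0#

  record Unitriangular (M : Matrix) : Set ℓ where
    field
      upper : UpperTriangular M
      diag  : ∀ t → M t t ≈ 1#

  mul-identityˡ : ∀ n M {p} q → p ℕ.< n → mul n identity M p q ≈ M p q
  mul-identityˡ n M {p} q p<n =
    trans (sumN-single n _ p<n (λ _ u≢p → trans (*-congʳ (identity-offDiag (u≢p ∘ ≡.sym))) (zeroˡ _)))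
          (trans (*-congʳ (identity-diag p)) (*-identityˡ _))

  mul-identityʳ : ∀ n M p {q} → q ℕ.< n → mul n M identity p q ≈ M p q
  mul-identityʳ n M p {q} q<n =
    trans (sumN-single n _ q<n (λ _ u≢q → trans (*-congˡ (identity-offDiag u≢q)) (zeroʳ _)))
          (trans (*-congˡ (identity-diag q)) (*-identityʳ _))

  mul-assoc : ∀ n L M N p q → mul n (mul n L M) N p q ≈ mul n L (mul n M N) p q
  mul-assoc n L M N p q = begin
    sumN R n (λ u → sumN R n (λ t → L p t * M t u) * N u q)
      ≈⟨ sumN-cong n (λ _ → *-distribʳ-sumN n _ _) ⟩
    sumN R n (λ u → sumN R n (λ t → L p t * M t u * N u q))
      ≈⟨ sumN-comm n n _ ⟩
    sumN R n (λ t → sumN R n (λ u → L p t * M t u * N u q))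
      ≈⟨ sumN-cong n (λ _ → sumN-cong n (λ _ → *-assoc _ _ _)) ⟩
    sumN R n (λ t → sumN R n (λ u → L p t * (M t u * N u q)))
      ≈⟨ sumN-cong n (λ _ → *-distribˡ-sumN n _ _) ⟨
    sumN R n (λ t → L p t * sumN R n (λ u → M t u * N u q))
      ∎

  mul-upperTriangular : ∀ n {M N} → UpperTriangular M → UpperTriangular N → UpperTriangular (mul n M N)
  mul-upperTriangular n {M} {N} M-upper N-upper {p} {q} q<p = sumN-zero n term≈0
    where
    term≈0 : ∀ {t} → t ℕ.< n → M p t * N t q ≈ 0#
    term≈0 {t} _ with t ℕ.<? p
    ... | yes t<p = trans (*-congʳ (M-upper t<p)) (zeroˡ _)
    ... | no  t≮p = trans (*-congˡ (N-upper (ℕP.<-≤-trans q<p (ℕP.≮⇒≥ t≮p)))) (zeroʳ _)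

  mul-upperTriangular-band : ∀ n {M N} → UpperTriangular M → UpperTriangular N → ∀ {p} m → p ℕ.+ m ℕ.< n →
    mul n M N p (p ℕ.+ m) ≈ sumN R (suc m) (λ d → M p (p ℕ.+ d) * N (p ℕ.+ d) (p ℕ.+ m))
  mul-upperTriangular-band n M-upper N-upper {p} m p+m<n = sumN-support n p m _ p+m<n
    (λ t<p → trans (*-congʳ (M-upper t<p)) (zeroˡ _))
    (λ p+m<t _ → trans (*-congˡ (N-upper p+m<t)) (zeroʳ _))

  unitriangular-cancelʳ : ∀ n {H} → Unitriangular H → ∀ {M N} →
    (∀ {p q} → p ℕ.< n → q ℕ.< n → mul n M H p q ≈ mul n N H p q) →
    ∀ {p q} → p ℕ.< n → q ℕ.< n → M p q ≈ N p q
  unitriangular-cancelʳ n {H} H-unitri {M} {N} MH≈NH {p} p<n =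
    <-rec (λ q → q ℕ.< n → M p q ≈ N p q) step _
    where
    open Unitriangular H-unitri
    D : ℕ → A
    D u = M p u - N p u
    step : ∀ q → (∀ {u} → u ℕ.< q → u ℕ.< n → M p u ≈ N p u) → q ℕ.< n → M p q ≈ N p q
    step q ih q<n = x∙y⁻¹≈ε⇒x≈y _ _ (begin
      D q                              ≈⟨ *-identityʳ _ ⟨
      D q * 1#                         ≈⟨ *-congˡ (diag q) ⟨
      D q * H q q                      ≈⟨ sumN-single n _ q<n other-terms ⟨
      sumN R n (λ u → D u * H u q)     ≈⟨ sumN-cong n (λ _ → [y-z]x≈yx-zx _ _ _) ⟩
      sumN R n (λ u → M p u * H u q - N p u * H u q)  ≈⟨ sumN-distrib-− n _ _ ⟩
      mul n M H p q - mul n N H p q    ≈⟨ x≈y⇒x∙y⁻¹≈ε (MH≈NH p<n q<n) ⟩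
      0#                               ∎)
      where
      other-terms : ∀ {u} → u ℕ.< n → u ≢ q → D u * H u q ≈ 0#
      other-terms {u} u<n u≢q with u ℕ.<? q
      ... | yes u<q = trans (*-congʳ (x≈y⇒x∙y⁻¹≈ε (ih u<q u<n))) (zeroˡ _)
      ... | no  u≮q = trans (*-congˡ (upper (ℕP.≤∧≢⇒< (ℕP.≮⇒≥ u≮q) (λ q≡u → u≢q (≡.sym q≡u))))) (zeroʳ _)

  unitriangular-inverseˡ⇒inverseʳ : ∀ n {H E} → Unitriangular H →
    (∀ {p q} → p ℕ.< n → q ℕ.< n → mul n E H p q ≈ identity p q) →
    ∀ {p q} → p ℕ.< n → q ℕ.< n → mul n H E p q ≈ identity p q
  unitriangular-inverseˡ⇒inverseʳ n {H} {E} H-unitri EH≈I = unitriangular-cancelʳ n H-unitri HEH≈IH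
    where
    HEH≈IH : ∀ {p q} → p ℕ.< n → q ℕ.< n → mul n (mul n H E) H p q ≈ mul n identity H p q
    HEH≈IH {p} {q} p<n q<n = begin
      mul n (mul n H E) H p q   ≈⟨ mul-assoc n H E H p q ⟩
      mul n H (mul n E H) p q   ≈⟨ sumN-cong n (λ t<n → *-congˡ (EH≈I t<n q<n)) ⟩
      mul n H identity p q      ≈⟨ mul-identityʳ n H p q<n ⟩
      H p q                     ≈⟨ mul-identityˡ n H q p<n ⟨
      mul n identity H p q      ∎

  hh-shift : ∀ x t r s → hh R (shiftGen t x) r s ≡ hh R x r (s ℤ.+ t)
  hh-shift x t (+ zero)  s = ≡.refl
  hh-shift x t (+ suc k) s = ≡.refl
  hh-shift x t -[1+ k ]  s = ≡.refl

  eMatrix : (ℕ → ℤ → A) → ℤ → ∀ {m} → Fin m → Fin m → A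
  eMatrix x s i j = hh R x (suc (toℕ j) ⊖ toℕ i) (ℤ.- (+ toℕ j) ℤ.+ s)

  ee-shift≈det : ∀ x s m → ee R (shiftGen s x) (+ m) ≈ det R m (eMatrix x s)
  ee-shift≈det x s m = det-cong m (λ i j → reflexive (entry (toℕ i) (toℕ j)))
    where
    order : ∀ I J → + 1 ℤ.- + 0 ℤ.- (1ℤ ℤ.+ I) ℤ.+ (1ℤ ℤ.+ J) ≡ (1ℤ ℤ.+ J) ℤ.- I
    order = solve-∀
    shift : ∀ J → + 0 ℤ.- (1ℤ ℤ.+ J) ℤ.+ 1ℤ ≡ ℤ.- J
    shift = solve-∀
    entry : ∀ i j → hh R (shiftGen s x) (+ 1 ℤ.- + 0 ℤ.- + suc i ℤ.+ + suc j) (+ 0 ℤ.- + suc j ℤ.+ 1ℤ)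
                  ≡ hh R x (suc j ⊖ i) (ℤ.- (+ j) ℤ.+ s)
    entry i j = ≡.trans
      (≡.cong₂ (hh R (shiftGen s x))
               (≡.trans (order (+ i) (+ j)) (ℤP.[+m]-[+n]≡m⊖n (suc j) i)) (shift (+ j)))
      (hh-shift x s (suc j ⊖ i) (ℤ.- (+ j)))

  eMatrix-suc : ∀ x s {m} (a b : Fin m) → eMatrix x s (suc a) (suc b) ≡ eMatrix x (s ℤ.+ -1ℤ) a b
  eMatrix-suc x s a b =
    ≡.cong₂ (hh R x) (ℤP.[1+m]⊖[1+n]≡m⊖n (suc (toℕ b)) (toℕ a)) (-[1+j]+i≡-j+[i-1] s (+ toℕ b))

  -- For j > 0 the minor keeps the column (1, 0, …, 0)ᵀ of eMatrix x s; expanding along it is a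
  -- step down the diagonal, and by eMatrix-suc such a step replaces s by s - 1.
  det-eMatrix-minor : ∀ x s m (j : Fin (suc m)) →
    det R m (λ a b → eMatrix x s (suc a) (punchIn j b))
      ≈ ee R (shiftGen (s ℤ.+ -[1+ toℕ j ]) x) (+ (m ∸ toℕ j))
  det-eMatrix-minor x s m zero =
    trans (det-cong m (λ a b → reflexive (eMatrix-suc x s a b))) (sym (ee-shift≈det x (s ℤ.+ -1ℤ) m))
  det-eMatrix-minor x s (suc m) (suc j) = begin
    det R (suc m) (λ a b → eMatrix x s (suc a) (punchIn (suc j) b))
      ≈⟨ det-firstColumn m (λ a b → eMatrix x s (suc a) (punchIn (suc j) b)) (λ _ → refl) ⟩
    1# * det R m (λ a b → eMatrix x s (suc (suc a)) (suc (punchIn j b)))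
      ≈⟨ *-identityˡ _ ⟩
    det R m (λ a b → eMatrix x s (suc (suc a)) (suc (punchIn j b)))
      ≈⟨ det-cong m (λ a b → reflexive (eMatrix-suc x s (suc a) (punchIn j b))) ⟩
    det R m (λ a b → eMatrix x (s ℤ.+ -1ℤ) (suc a) (punchIn j b))
      ≈⟨ det-eMatrix-minor x (s ℤ.+ -1ℤ) m j ⟩
    ee R (shiftGen (s ℤ.+ -1ℤ ℤ.+ -[1+ toℕ j ]) x) (+ (m ∸ toℕ j))
      ≡⟨ ≡.cong (λ t → ee R (shiftGen t x) (+ (m ∸ toℕ j))) (ℤP.+-assoc s -1ℤ -[1+ toℕ j ]) ⟩
    ee R (shiftGen (s ℤ.+ -[1+ suc (toℕ j) ]) x) (+ (m ∸ toℕ j)) ∎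

  ee-recurrence : ∀ x s m → ee R (shiftGen s x) (+ suc m) ≈ sumN R (suc m) (λ j →
    signℕ R j * (x j (ℤ.- (+ j) ℤ.+ s) * ee R (shiftGen (s ℤ.+ -[1+ j ]) x) (+ (m ∸ j))))
  ee-recurrence x s m = trans (ee-shift≈det x s (suc m))
    (trans (sumFin-cong (suc m) (λ j →
             *-congˡ {signℕ R (toℕ j)} (*-congˡ {eMatrix x s zero j} (det-eMatrix-minor x s m j))))
           (reflexive (sumFin-toℕ (suc m) term)))
    where
    term : ℕ → A
    term j = signℕ R j * (x j (ℤ.- (+ j) ℤ.+ s) * ee R (shiftGen (s ℤ.+ -[1+ j ]) x) (+ (m ∸ j)))

  hh-negative : ∀ x {r} s → r ℤ.< 0ℤ → hh R x r s ≡ 0#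
  hh-negative x { -[1+ _ ]} s _           = ≡.refl
  hh-negative x {+ _}      s (ℤ.+<+ ())

  ee-negative : ∀ x {r} → r ℤ.< 0ℤ → ee R x r ≡ 0#
  ee-negative x { -[1+ _ ]} _           = ≡.refl
  ee-negative x {+ _}      (ℤ.+<+ ())

  Htilde-upper : ∀ x {i k} → k ℤ.< i → Htilde R x i k ≈ 0#
  Htilde-upper x k<i = reflexive (hh-negative x _ (i<j⇒i-j<0 k<i))

  Htilde-diag : ∀ x i → Htilde R x i i ≈ 1#
  Htilde-diag x i = reflexive (≡.cong (λ r → hh R x r (1ℤ ℤ.+ i)) (ℤP.+-inverseʳ i))

  Etilde-upper : ∀ x {i k} → k ℤ.< i → Etilde R x i k ≈ 0#
  Etilde-upper x k<i = trans (*-congˡ (reflexive (ee-negative _ (i<j⇒i-j<0 k<i)))) (zeroʳ _)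

  Etilde-band : ∀ x c d → Etilde R x c (c ℤ.+ + d) ≡ signℕ R d * ee R (shiftGen (c ℤ.+ + d) x) (+ d)
  Etilde-band x c d = ≡.cong (λ r → signℤ R r * ee R (shiftGen (c ℤ.+ + d) x) r) (i+j-i≡j c (+ d))

  Htilde-band : ∀ x u r → Htilde R x u (u ℤ.+ + r) ≡ hh R x (+ r) (1ℤ ℤ.+ u)
  Htilde-band x u r = ≡.cong (λ z → hh R x z (1ℤ ℤ.+ u)) (i+j-i≡j u (+ r))

  sign[1+j+d]*sign[j]≈-sign[d] : ∀ j d → signℕ R (suc (j ℕ.+ d)) * signℕ R j ≈ - signℕ R d
  sign[1+j+d]*sign[j]≈-sign[d] zero    d = *-identityʳ _
  sign[1+j+d]*sign[j]≈-sign[d] (suc j) d = trans (-x*-y≈x*y _ _) (sign[1+j+d]*sign[j]≈-sign[d] j d)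
    where
    -x*-y≈x*y : ∀ a b → - a * - b ≈ a * b
    -x*-y≈x*y a b =
      trans (sym (-‿distribˡ-* a (- b))) (trans (-‿cong (sym (-‿distribʳ-* a b))) (-‿involutive _))

  EH-band-diag : ∀ x c → sumN R 1 (λ d → Etilde R x c (c ℤ.+ + d) * Htilde R x (c ℤ.+ + d) (c ℤ.+ + 0)) ≈ 1#
  EH-band-diag x c = begin
    Etilde R x c (c ℤ.+ + 0) * Htilde R x (c ℤ.+ + 0) (c ℤ.+ + 0) + 0#
      ≈⟨ +-identityʳ _ ⟩
    Etilde R x c (c ℤ.+ + 0) * Htilde R x (c ℤ.+ + 0) (c ℤ.+ + 0)
      ≈⟨ *-cong (reflexive (Etilde-band x c 0)) (Htilde-diag x (c ℤ.+ + 0)) ⟩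
    (1# * 1#) * 1#
      ≈⟨ trans (*-identityʳ _) (*-identityˡ _) ⟩
    1# ∎

  EH-band-term-cancel : ∀ x c {m j d} → j ℕ.+ d ≡ m →
    Etilde R x c (c ℤ.+ + d) * Htilde R x (c ℤ.+ + d) (c ℤ.+ + suc m) +
    signℕ R (suc m) * (signℕ R j * (x j (ℤ.- (+ j) ℤ.+ (c ℤ.+ + suc m)) *
                                    ee R (shiftGen (c ℤ.+ + suc m ℤ.+ -[1+ j ]) x) (+ d))) ≈ 0#
  EH-band-term-cancel x c {j = j} {d} ≡.refl = begin
    Etilde R x c u * Htilde R x u s + σ * term s
      ≡⟨ ≡.cong (λ v → Etilde R x c u * Htilde R x u v + σ * term v) s≡u+[1+j] ⟩
    Etilde R x c u * Htilde R x u (u ℤ.+ + suc j) + σ * term (u ℤ.+ + suc j)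
      ≡⟨ ≡.cong₂ _+_ (≡.cong₂ _*_ (Etilde-band x c d) (Htilde-band x u (suc j))) (≡.cong (σ *_) term≡) ⟩
    (signℕ R d * E) * X + σ * (signℕ R j * (X * E))
      ≈⟨ +-congˡ (trans (sym (*-assoc _ _ _)) (*-congʳ (sign[1+j+d]*sign[j]≈-sign[d] j d))) ⟩
    (signℕ R d * E) * X + - signℕ R d * (X * E)
      ≈⟨ +-cong (trans (*-assoc _ _ _) (*-congˡ (*-comm E X))) (sym (-‿distribˡ-* _ _)) ⟩
    signℕ R d * (X * E) - signℕ R d * (X * E)
      ≈⟨ -‿inverseʳ _ ⟩
    0# ∎
    where
    u s : ℤ
    u = c ℤ.+ + d
    s = c ℤ.+ + suc (j ℕ.+ d)
    σ E X : A
    σ = signℕ R (suc (j ℕ.+ d))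
    E = ee R (shiftGen u x) (+ d)
    X = x j (1ℤ ℤ.+ u)
    term : ℤ → A
    term v = signℕ R j * (x j (ℤ.- (+ j) ℤ.+ v) * ee R (shiftGen (v ℤ.+ -[1+ j ]) x) (+ d))
    s≡u+[1+j] : s ≡ u ℤ.+ + suc j
    s≡u+[1+j] =
      ≡.trans (≡.cong (λ z → c ℤ.+ (1ℤ ℤ.+ z)) (ℤP.pos-+ j d)) (i+[1+[j+k]]≡[i+k]+[1+j] c (+ j) (+ d))
    term≡ : term (u ℤ.+ + suc j) ≡ signℕ R j * (X * E)
    term≡ = ≡.cong₂ (λ v w → signℕ R j * (x j v * ee R (shiftGen w x) (+ d)))
                    (-j+[i+[1+j]]≡1+i u (+ j)) (i+[1+j]-[1+j]≡i u (+ j))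

  -- Reversed, the band sum cancels term by term against the expansion of its last term.
  EH-band-offDiag : ∀ x c m →
    sumN R (suc (suc m)) (λ d → Etilde R x c (c ℤ.+ + d) * Htilde R x (c ℤ.+ + d) (c ℤ.+ + suc m)) ≈ 0#
  EH-band-offDiag x c m = begin
    sumN R (suc (suc m)) B                                 ≈⟨ sumN-init-last (suc m) B ⟩
    sumN R (suc m) B + B (suc m)                           ≈⟨ +-cong (sumN-reverse m B) last-term ⟨
    sumN R (suc m) B-reversed + σ * sumN R (suc m) term    ≈⟨ +-congˡ (*-distribˡ-sumN (suc m) σ term) ⟩
    sumN R (suc m) B-reversed + sumN R (suc m) σ-term      ≈⟨ sumN-distrib-+ (suc m) B-reversed σ-term ⟨
    sumN R (suc m) (λ j → B-reversed j + σ-term j)         ≈⟨ sumN-zero (suc m) {λ j → B-reversed j + σ-term j}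
                                                                (λ j≤m → EH-band-term-cancel x c (ℕP.m+[n∸m]≡n (ℕP.≤-pred j≤m))) ⟩
    0#                                                     ∎
    where
    s : ℤ
    s = c ℤ.+ + suc m
    σ : A
    σ = signℕ R (suc m)
    B : ℕ → A
    B d = Etilde R x c (c ℤ.+ + d) * Htilde R x (c ℤ.+ + d) s
    B-reversed : ℕ → A
    B-reversed j = B (m ∸ j)
    term : ℕ → A
    term j = signℕ R j * (x j (ℤ.- (+ j) ℤ.+ s) * ee R (shiftGen (s ℤ.+ -[1+ j ]) x) (+ (m ∸ j)))
    σ-term : ℕ → A
    σ-term j = σ * term j
    last-term : σ * sumN R (suc m) term ≈ B (suc m)
    last-term = sym (trans (*-cong (reflexive (Etilde-band x c (suc m))) (Htilde-diag x s))
                           (trans (*-identityʳ _) (*-congˡ (ee-recurrence x s m))))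

  window : ℤ → (ℤ → ℤ → A) → Matrix
  window a M t u = M (a ℤ.+ + t) (a ℤ.+ + u)

  window-upperTriangular : ∀ a {M} → (∀ {i k} → k ℤ.< i → M i k ≈ 0#) → UpperTriangular (window a M)
  window-upperTriangular a M-upper u<t = M-upper (ℤP.+-monoʳ-< a (ℤ.+<+ u<t))

  window-Htilde-unitriangular : ∀ x a → Unitriangular (window a (Htilde R x))
  window-Htilde-unitriangular x a = record
    { upper = window-upperTriangular a (Htilde-upper x)
    ; diag  = λ t → Htilde-diag x (a ℤ.+ + t)
    }

  δ-window : ∀ a p q → δ R (a ℤ.+ + p) (a ℤ.+ + q) ≡ identity p q
  δ-window a p q with p ℕ.≟ q | a ℤ.+ + p ℤ.≟ a ℤ.+ + q
  ... | yes _   | yes _ = ≡.refl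
  ... | no  _   | no  _ = ≡.refl
  ... | yes p≡q | no  a+p≢a+q = ⊥-elim (a+p≢a+q (≡.cong (λ r → a ℤ.+ + r) p≡q))
  ... | no  p≢q | yes a+p≡a+q = ⊥-elim (p≢q (ℤP.+-injective (ℤ+.∙-cancelˡ a (+ p) (+ q) a+p≡a+q)))

  window-Etilde-upperTriangular : ∀ x a → UpperTriangular (window a (Etilde R x))
  window-Etilde-upperTriangular x a = window-upperTriangular a (Etilde-upper x)

  EH-window-band : ∀ x a n {p} m → p ℕ.+ m ℕ.< n →
    mul n (window a (Etilde R x)) (window a (Htilde R x)) p (p ℕ.+ m) ≈ identity p (p ℕ.+ m)
  EH-window-band x a n {p} m p+m<n = begin
    mul n Ẽ H̃ p (p ℕ.+ m)
      ≈⟨ mul-upperTriangular-band n (window-Etilde-upperTriangular x a) H̃-upper m p+m<n ⟩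
    sumN R (suc m) (λ d → Ẽ p (p ℕ.+ d) * H̃ (p ℕ.+ d) (p ℕ.+ m))
      ≈⟨ sumN-cong (suc m) (λ {d} _ → reflexive
           (≡.cong₂ (λ u v → Etilde R x c u * Htilde R x u v) (a+[p+d]≡c+d d) (a+[p+d]≡c+d m))) ⟩
    sumN R (suc m) (λ d → Etilde R x c (c ℤ.+ + d) * Htilde R x (c ℤ.+ + d) (c ℤ.+ + m))
      ≈⟨ band m ⟩
    identity p (p ℕ.+ m) ∎
    where
    Ẽ H̃ : Matrix
    Ẽ = window a (Etilde R x)
    H̃ = window a (Htilde R x)
    H̃-upper : UpperTriangular H̃
    H̃-upper = Unitriangular.upper (window-Htilde-unitriangular x a)
    c : ℤ
    c = a ℤ.+ + p
    a+[p+d]≡c+d : ∀ d → a ℤ.+ + (p ℕ.+ d) ≡ c ℤ.+ + d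
    a+[p+d]≡c+d d = ≡.trans (≡.cong (λ r → a ℤ.+ r) (ℤP.pos-+ p d)) (≡.sym (ℤP.+-assoc a (+ p) (+ d)))
    band : ∀ m → sumN R (suc m) (λ d → Etilde R x c (c ℤ.+ + d) * Htilde R x (c ℤ.+ + d) (c ℤ.+ + m))
                 ≈ identity p (p ℕ.+ m)
    band zero    = trans (EH-band-diag x c)
                         (sym (trans (reflexive (≡.cong (identity p) (ℕP.+-identityʳ p))) (identity-diag p)))
    band (suc m) = trans (EH-band-offDiag x c m) (sym (identity-offDiag (ℕP.<⇒≢ (ℕP.m<m+n p (s≤s z≤n)))))

  EH-window : ∀ x a n {p q} → p ℕ.< n → q ℕ.< n →
    mul n (window a (Etilde R x)) (window a (Htilde R x)) p q ≈ identity p q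
  EH-window x a n {p} {q} _ q<n with q ℕ.<? p
  ... | yes q<p = trans
    (mul-upperTriangular n (window-Etilde-upperTriangular x a)
                           (Unitriangular.upper (window-Htilde-unitriangular x a)) q<p)
    (sym (identity-offDiag (λ p≡q → ℕP.<⇒≢ q<p (≡.sym p≡q))))
  ... | no q≮p with q ∸ p | ℕP.m+[n∸m]≡n (ℕP.≮⇒≥ q≮p)
  ...   | m | ≡.refl = EH-window-band x a n m q<n

  window-inverse : ∀ x a n {p q} → p ℕ.< n → q ℕ.< n →
    mul n (window a (Htilde R x)) (window a (Etilde R x)) p q ≈ δ R (a ℤ.+ + p) (a ℤ.+ + q) ×
    mul n (window a (Etilde R x)) (window a (Htilde R x)) p q ≈ δ R (a ℤ.+ + p) (a ℤ.+ + q)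
  window-inverse x a n {p} {q} p<n q<n =
    trans (unitriangular-inverseˡ⇒inverseʳ n (window-Htilde-unitriangular x a) (EH-window x a n) p<n q<n) I≈δ
    , trans (EH-window x a n p<n q<n) I≈δ
    where
    I≈δ : identity p q ≈ δ R (a ℤ.+ + p) (a ℤ.+ + q)
    I≈δ = reflexive (≡.sym (δ-window a p q))

open import Data.Integer using (ℤ; +_; _+_; _≤_; _<_)

mainTheorem10 : ∀ {c ℓ} (R : CommutativeRing c ℓ) (x : ℕ → ℤ → CommutativeRing.Carrier R)
    (i k a : ℤ) (n : ℕ) → a ≤ i → a ≤ k → i < a + + n → k < a + + n →
    CommutativeRing._≈_ R
      (sumN R n (λ t → CommutativeRing._*_ R (Htilde R x i (a + + t)) (Etilde R x (a + + t) k)))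
      (δ R i k)
    × CommutativeRing._≈_ R
      (sumN R n (λ t → CommutativeRing._*_ R (Etilde R x i (a + + t)) (Htilde R x (a + + t) k)))
      (δ R i k)
mainTheorem10 R x i k a n a≤i a≤k i<a+n k<a+n with window-index a≤i i<a+n | window-index a≤k k<a+n
... | p , p<n , ≡.refl | q , q<n , ≡.refl = window-inverse R x a n p<n q<n
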